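{- Every non-locatable graph $G$ of diameter $2$ contains $C_5$, $K_4$, $K_2\oplus E_3$ or $K_{3,3}$ as a (not necessarily induced) subgraph.
   Context: $K_2\oplus E_3$ denotes the graph formed by an edge $xy$ together with three pairwise non-adjacent vertices each adjacent to both $x$ and $y$. The robber-locating game on a finite connected simple graph $G$: a robber occupies an unknown vertex. In each round the cop probes any vertex $p$ of $G$ (no restriction), and the robber truthfully announces the graph distance from his current vertex to $p$. If the information gathered so far determines the robber's current vertex uniquely, the cop wins. Otherwise the robber moves to an adjacent vertex or stays put, with the no-backtrack condition: he may not move to the vertex $p$ just probed. The robber is omniscient. $G$ is locatable if the cop has a strategy guaranteed to determine the robber's vertex after finitely many probes, and non-locatable otherwise. -}

module Defs where

open import Data.Nat using (ℕ; zero; suc; _≤_; _<_; _<ᵇ_; _≡ᵇ_; _%_)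
open import Data.Fin using (Fin; toℕ)
open import Data.Bool using (Bool; true; false; _∨_; _∧_; not; _xor_)
open import Data.Product using (Σ; ∃; ∃-syntax; _×_; _,_)
open import Data.Sum using (_⊎_)
open import Data.Unit using (⊤)
open import Relation.Nullary using (¬_)
open import Relation.Binary.PropositionalEquality using (_≡_; _≢_)
open import Function.Definitions using (Injective)

record SimpleGraph (n : ℕ) : Set where
  field
    adj    : Fin n → Fin n → Bool
    sym    : ∀ u v → adj u v ≡ adj v u
    irrefl : ∀ v → adj v v ≡ false
open SimpleGraph public

module _ {n : ℕ} (G : SimpleGraph n) where

  data Walk : Fin n → Fin n → ℕ → Set where
    here : ∀ {u} → Walk u u zero
    step : ∀ {u v w k} → adj G u v ≡ true → Walk v w k → Walk u w (suc k)

  Dist : Fin n → Fin n → ℕ → Set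
  Dist u v d = Walk u v d × (∀ k → k < d → ¬ Walk u v k)

  HasDiameter : ℕ → Set
  HasDiameter D = (∀ u v → ∃[ d ] (d ≤ D × Dist u v d))
                × (∃[ u ] ∃[ v ] Dist u v D)

  -- The robber-locating game.  The cop's knowledge is the set S of
  -- vertices the robber may currently occupy.

  Answer : (Fin n → Set) → Fin n → ℕ → Fin n → Set
  Answer S p d v = S v × Dist v p d

  Determined : (Fin n → Set) → Set
  Determined S = ∃[ v ] (∀ w → S w → w ≡ v)

  Move : Fin n → (Fin n → Set) → Fin n → Set
  Move p S w = ∃[ v ] (S v × (w ≡ v ⊎ (adj G v w ≡ true × w ≢ p)))

  -- the cop has a strategy which locates the robber in finitely many
  -- probes, starting from knowledge set S (inductive = well-founded
  -- strategy tree, adversarial over all answers)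
  data Locating : (Fin n → Set) → Set₁ where
    probe : ∀ {S} (p : Fin n) →
            (∀ d → Determined (Answer S p d)
                   ⊎ Locating (Move p (Answer S p d))) →
            Locating S

  Locatable : Set₁
  Locatable = Locating (λ _ → ⊤)

Pattern : ℕ → Set
Pattern k = Fin k → Fin k → Bool

ContainsSubgraph : ∀ {n k} → SimpleGraph n → Pattern k → Set
ContainsSubgraph {n} {k} G H =
  Σ (Fin k → Fin n) λ f → Injective _≡_ _≡_ f ×
    (∀ i j → H i j ≡ true → adj G (f i) (f j) ≡ true)

C5 : Pattern 5
C5 i j = (toℕ j ≡ᵇ suc (toℕ i) % 5) ∨ (toℕ i ≡ᵇ suc (toℕ j) % 5)

K4 : Pattern 4
K4 i j = not (toℕ i ≡ᵇ toℕ j)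

-- K₂ ⊕ E₃ : edge 0–1, vertices 2,3,4 pairwise non-adjacent, each adjacent to 0 and 1
K2⊕E3 : Pattern 5
K2⊕E3 i j = not (toℕ i ≡ᵇ toℕ j) ∧ ((toℕ i <ᵇ 2) ∨ (toℕ j <ᵇ 2))

K33 : Pattern 6
K33 i j = (toℕ i <ᵇ 3) xor (toℕ j <ᵇ 3)

module Submission where

-- Each of the four patterns is searched for exhaustively; if one is found it
-- is a subgraph, so it remains to show that a diameter-2 graph G free of all
-- four is locatable.  Two cases, according to whether G has a universal
-- vertex c (adjacent to every other vertex).
--
-- * With c: since G has no C₅, K₄ or K₂ ⊕ E₃, the components of G − c are
--   stars with at most two leaves.  The cop removes them one by one: probing
--   the centre m of a star either finds the robber, traps him among the two
--   leaves of m and c, or confines him to the other components plus c.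
--
-- * Without one: G has no C₅ and diameter 2, so a path on four vertices
--   with non-adjacent ends has a further chord; with no K₄ and no universal vertex this makes G
--   triangle-free, hence complete bipartite, and with no K₃,₃ one side is a
--   pair {a, b} of "hubs".  The cop alternates probes of a and of the other
--   vertices, ruling those out one at a time.
--
-- Both strategies proceed by recursion over a list of still-possible
-- vertices.

open import Defs hiding (sym)
open import Data.Nat using (ℕ; zero; suc; _+_; s≤s; z≤n)
open import Data.Fin using (Fin; _≟_)
open import Data.Fin.Patterns using (0F; 1F; 2F; 3F; 4F; 5F)
open import Data.Fin.Properties using (any?; all?; ¬∀⟶∃¬)
import Data.Bool as Bool
open import Data.Product using (∃; ∃-syntax; _×_; _,_; proj₁; proj₂)
open import Data.Product.Properties using (≡-dec)
open import Data.Sum using (_⊎_; inj₁; inj₂)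
open import Data.Empty using (⊥; ⊥-elim)
open import Data.List using (List; []; _∷_; allFin)
open import Data.List.Membership.Propositional using (_∈_)
open import Data.List.Membership.Propositional.Properties using (∈-allFin; ∉[])
open import Data.Unit using (⊤)
open import Data.List.Relation.Unary.Any using () renaming (tail to ∈-tail)
import Data.List.Relation.Unary.All as All
open All using ([]; _∷_)
open import Data.Vec using (Vec; []; _∷_; lookup)
open import Data.Vec.Relation.Unary.Unique.Propositional using (Unique; []; _∷_)
open import Data.Vec.Relation.Unary.Unique.Propositional.Properties using (lookup-injective)
open import Data.Vec.Relation.Unary.AllPairs using (allPairs?)
open import Data.Vec.Relation.Unary.All using ([]; _∷_)
open import Relation.Nullary using (¬_; Dec; yes; no; ¬?)
open import Relation.Nullary.Decidable using (_×-dec_; _⊎-dec_; _→-dec_; map′; from-yes)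
open import Relation.Unary using (_⊆_; Decidable)
open import Relation.Binary.PropositionalEquality
  using (_≡_; _≢_; refl; trans; subst; ≢-sym) renaming (sym to ≡-sym)

Describes : ∀ {k} → Pattern k → List (Fin k × Fin k) → Set
Describes H L = ∀ i j → H i j ≡ Bool.true → (i , j) ∈ L ⊎ (j , i) ∈ L

describes? : ∀ {k} (H : Pattern k) L → Dec (Describes H L)
describes? {k} H L = all? λ i → all? λ j →
  (H i j Bool.≟ Bool.true) →-dec ((i , j) ∈? L ⊎-dec (j , i) ∈? L)
  where open import Data.List.Membership.DecPropositional (≡-dec (_≟_ {k}) _≟_) using (_∈?_)

c5-edges : List (Fin 5 × Fin 5)
c5-edges = (0F , 1F) ∷ (1F , 2F) ∷ (2F , 3F) ∷ (3F , 4F) ∷ (4F , 0F) ∷ []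

k4-edges : List (Fin 4 × Fin 4)
k4-edges = (0F , 1F) ∷ (0F , 2F) ∷ (0F , 3F) ∷ (1F , 2F) ∷ (1F , 3F) ∷ (2F , 3F) ∷ []

k2⊕e3-edges : List (Fin 5 × Fin 5)
k2⊕e3-edges = (0F , 1F) ∷ (0F , 2F) ∷ (0F , 3F) ∷ (0F , 4F)
            ∷ (1F , 2F) ∷ (1F , 3F) ∷ (1F , 4F) ∷ []

k33-edges : List (Fin 6 × Fin 6)
k33-edges = (0F , 3F) ∷ (0F , 4F) ∷ (0F , 5F) ∷ (1F , 3F) ∷ (1F , 4F)
          ∷ (1F , 5F) ∷ (2F , 3F) ∷ (2F , 4F) ∷ (2F , 5F) ∷ []

c5-described : Describes C5 c5-edges
c5-described = from-yes (describes? C5 c5-edges)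

k4-described : Describes K4 k4-edges
k4-described = from-yes (describes? K4 k4-edges)

k2⊕e3-described : Describes K2⊕E3 k2⊕e3-edges
k2⊕e3-described = from-yes (describes? K2⊕E3 k2⊕e3-edges)

k33-described : Describes K33 k33-edges
k33-described = from-yes (describes? K33 k33-edges)

any-vec? : ∀ {n k} {P : Vec (Fin n) k → Set} → (∀ vs → Dec (P vs)) → Dec (∃ P)
any-vec? {k = zero}  P? = map′ ([] ,_) (λ { ([] , p) → p }) (P? [])
any-vec? {k = suc k} P? =
  map′ (λ (v , vs , p) → v ∷ vs , p) (λ { (v ∷ vs , p) → v , vs , p })
       (any? λ v → any-vec? λ vs → P? (v ∷ vs))

module Graph {n : ℕ} (G : SimpleGraph n) where

  Adj : Fin n → Fin n → Set
  Adj u v = adj G u v ≡ Bool.true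

  adj? : ∀ u v → Dec (Adj u v)
  adj? u v = adj G u v Bool.≟ Bool.true

  adj-sym : ∀ {u v} → Adj u v → Adj v u
  adj-sym {u} {v} e = trans (SimpleGraph.sym G v u) e

  adj⇒≢ : ∀ {u v} → Adj u v → u ≢ v
  adj⇒≢ {u} e refl with trans (≡-sym e) (irrefl G u)
  ... | ()

  Edges : ∀ {k} → List (Fin k × Fin k) → Vec (Fin n) k → Set
  Edges L vs = All.All (λ (i , j) → Adj (lookup vs i) (lookup vs j)) L

  Copy : ∀ {k} → List (Fin k × Fin k) → Set
  Copy L = ∃[ vs ] (Unique vs × Edges L vs)

  copy? : ∀ {k} (L : List (Fin k × Fin k)) → Dec (Copy L)
  copy? L = any-vec? λ vs →
    allPairs? (λ u v → ¬? (u ≟ v)) vs ×-dec All.all? (λ (i , j) → adj? _ _) L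

  embed : ∀ {k} {H : Pattern k} {L} → Describes H L → Copy L → ContainsSubgraph G H
  embed {L = L} described (vs , distinct , edges) =
    lookup vs , (λ {i} {j} → lookup-injective distinct i j) , homomorphic
    where
    homomorphic : ∀ i j → _ → Adj (lookup vs i) (lookup vs j)
    homomorphic i j Hij with described i j Hij
    ... | inj₁ ij = All.lookup edges ij
    ... | inj₂ ji = adj-sym (All.lookup edges ji)

  search : ∀ {k} {H : Pattern k} {L} → Describes H L → ContainsSubgraph G H ⊎ ¬ Copy L
  search {L = L} described with copy? L
  ... | yes copy = inj₁ (embed described copy)
  ... | no none = inj₂ none

  universal-or-not : (∃[ c ] ∀ {v} → v ≢ c → Adj c v) ⊎ (∀ v → ∃[ w ] (w ≢ v × ¬ Adj w v))
  universal-or-not with any? (λ c → all? λ v → (v ≟ c) ⊎-dec adj? v c)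
  ... | yes (c , c-universal) = inj₁ (c , universal)
    where
    universal : ∀ {v} → v ≢ c → Adj c v
    universal {v} v≢c with c-universal v
    ... | inj₁ v≡c = ⊥-elim (v≢c v≡c)
    ... | inj₂ vc = adj-sym vc
  ... | no no-universal = inj₂ non-neighbour
    where
    non-neighbour : ∀ v → ∃[ w ] (w ≢ v × ¬ Adj w v)
    non-neighbour v with ¬∀⟶∃¬ n _ (λ w → (w ≟ v) ⊎-dec adj? w v) (λ all → no-universal (v , all))
    ... | w , neither = w , (λ w≡v → neither (inj₁ w≡v)) , (λ wv → neither (inj₂ wv))

  -- G is complete bipartite with one side {a, b} (the "hubs")
  record Hubs (a b : Fin n) : Set where
    field
      apart    : ¬ Adj a b
      joined   : ∀ {v} → v ≢ a → v ≢ b → Adj v a × Adj v b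
      confined : ∀ {v u} → v ≢ a → v ≢ b → Adj v u → u ≡ a ⊎ u ≡ b

  -- Refuting the four patterns from their edges; distinctness of adjacent
  -- vertices is automatic, so only the non-adjacent pairs are asked for.

  no-C5 : ¬ Copy c5-edges → ∀ {a b c d e} →
          Adj a b → Adj b c → Adj c d → Adj d e → Adj e a →
          a ≢ c → a ≢ d → b ≢ d → b ≢ e → c ≢ e → ⊥
  no-C5 none ab bc cd de ea a≢c a≢d b≢d b≢e c≢e = none
    ( _ ∷ _ ∷ _ ∷ _ ∷ _ ∷ []
    , (adj⇒≢ ab ∷ a≢c ∷ a≢d ∷ ≢-sym (adj⇒≢ ea) ∷ [])
      ∷ (adj⇒≢ bc ∷ b≢d ∷ b≢e ∷ [])
      ∷ (adj⇒≢ cd ∷ c≢e ∷ [])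
      ∷ (adj⇒≢ de ∷ []) ∷ [] ∷ []
    , ab ∷ bc ∷ cd ∷ de ∷ ea ∷ [] )

  no-K4 : ¬ Copy k4-edges → ∀ {a b c d} →
          Adj a b → Adj a c → Adj a d → Adj b c → Adj b d → Adj c d → ⊥
  no-K4 none ab ac ad bc bd cd = none
    ( _ ∷ _ ∷ _ ∷ _ ∷ []
    , (adj⇒≢ ab ∷ adj⇒≢ ac ∷ adj⇒≢ ad ∷ [])
      ∷ (adj⇒≢ bc ∷ adj⇒≢ bd ∷ [])
      ∷ (adj⇒≢ cd ∷ []) ∷ [] ∷ []
    , ab ∷ ac ∷ ad ∷ bc ∷ bd ∷ cd ∷ [] )

  no-K2⊕E3 : ¬ Copy k2⊕e3-edges → ∀ {x y u v w} →
             Adj x y → Adj x u → Adj x v → Adj x w → Adj y u → Adj y v → Adj y w →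
             u ≢ v → u ≢ w → v ≢ w → ⊥
  no-K2⊕E3 none xy xu xv xw yu yv yw u≢v u≢w v≢w = none
    ( _ ∷ _ ∷ _ ∷ _ ∷ _ ∷ []
    , (adj⇒≢ xy ∷ adj⇒≢ xu ∷ adj⇒≢ xv ∷ adj⇒≢ xw ∷ [])
      ∷ (adj⇒≢ yu ∷ adj⇒≢ yv ∷ adj⇒≢ yw ∷ [])
      ∷ (u≢v ∷ u≢w ∷ [])
      ∷ (v≢w ∷ []) ∷ [] ∷ []
    , xy ∷ xu ∷ xv ∷ xw ∷ yu ∷ yv ∷ yw ∷ [] )

  no-K33 : ¬ Copy k33-edges → ∀ {a b c d e f} →
           Adj a d → Adj a e → Adj a f → Adj b d → Adj b e → Adj b f →
           Adj c d → Adj c e → Adj c f →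
           a ≢ b → a ≢ c → b ≢ c → d ≢ e → d ≢ f → e ≢ f → ⊥
  no-K33 none ad ae af bd be bf cd ce cf a≢b a≢c b≢c d≢e d≢f e≢f = none
    ( _ ∷ _ ∷ _ ∷ _ ∷ _ ∷ _ ∷ []
    , (a≢b ∷ a≢c ∷ adj⇒≢ ad ∷ adj⇒≢ ae ∷ adj⇒≢ af ∷ [])
      ∷ (b≢c ∷ adj⇒≢ bd ∷ adj⇒≢ be ∷ adj⇒≢ bf ∷ [])
      ∷ (adj⇒≢ cd ∷ adj⇒≢ ce ∷ adj⇒≢ cf ∷ [])
      ∷ (d≢e ∷ d≢f ∷ [])
      ∷ (e≢f ∷ []) ∷ [] ∷ []
    , ad ∷ ae ∷ af ∷ bd ∷ be ∷ bf ∷ cd ∷ ce ∷ cf ∷ [] )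

-- The game: knowing less never helps the robber

module Game {n : ℕ} (G : SimpleGraph n) where

  determined-mono : ∀ {S T : Fin n → Set} → S ⊆ T → Determined G T → Determined G S
  determined-mono S⊆T (v , unique) = v , λ w Sw → unique w (S⊆T Sw)

  move-mono : ∀ {S T : Fin n → Set} p → S ⊆ T → Move G p S ⊆ Move G p T
  move-mono p S⊆T (v , Sv , moved) = v , S⊆T Sv , moved

  locating-mono : ∀ {S T : Fin n → Set} → S ⊆ T → Locating G T → Locating G S
  locating-mono {S} {T} S⊆T (probe p next) = probe p answer
    where
    answer : ∀ d → Determined G (Answer G S p d) ⊎ Locating G (Move G p (Answer G S p d))
    answer d with next d
    ... | inj₁ det = inj₁ (determined-mono (λ (Sv , dist) → S⊆T Sv , dist) det)
    ... | inj₂ loc = inj₂ (locating-mono (move-mono p (λ (Sv , dist) → S⊆T Sv , dist)) loc)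

  Branch : Fin n → (Fin n → Set) → Set₁
  Branch p X = Determined G X ⊎ Locating G (Move G p X)

  branch-mono : ∀ {p} {X Y : Fin n → Set} → X ⊆ Y → Branch p Y → Branch p X
  branch-mono X⊆Y (inj₁ det) = inj₁ (determined-mono X⊆Y det)
  branch-mono {p} X⊆Y (inj₂ loc) = inj₂ (locating-mono (move-mono p X⊆Y) loc)

-- Graphs of diameter 2: every probe answers 0, 1 or 2

module Diameter2 {n : ℕ} (G : SimpleGraph n) (diam : HasDiameter G 2) where
  open Graph G
  open Game G

  Far : Fin n → Fin n → Set
  Far p v = v ≢ p × ¬ Adj v p

  private
    walk-0 : ∀ {u v} → Walk G u v 0 → u ≡ v
    walk-0 here = refl

    walk-1 : ∀ {u v} → Walk G u v 1 → Adj u v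
    walk-1 (step e here) = e

    dist-2 : ∀ {u v} → Dist G u v 2 → Far v u
    dist-2 {u} (_ , shorter) =
      (λ { refl → shorter 0 (s≤s z≤n) here }) , (λ e → shorter 1 (s≤s (s≤s z≤n)) (step e here))

    dist-≥3 : ∀ {u v k} → ¬ Dist G u v (3 + k)
    dist-≥3 {u} {v} (_ , shorter) with proj₁ diam u v
    ... | 0 , _ , (w , _) = shorter 0 (s≤s z≤n) w
    ... | 1 , _ , (w , _) = shorter 1 (s≤s (s≤s z≤n)) w
    ... | 2 , _ , (w , _) = shorter 2 (s≤s (s≤s (s≤s z≤n))) w
    ... | suc (suc (suc _)) , s≤s (s≤s ()) , _

  common-neighbour : ∀ {u v} → u ≢ v → ¬ Adj u v → ∃[ w ] (Adj u w × Adj w v)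
  common-neighbour {u} {v} u≢v ¬uv with proj₁ diam u v
  ... | 0 , _ , (here , _) = ⊥-elim (u≢v refl)
  ... | 1 , _ , (step e here , _) = ⊥-elim (¬uv e)
  ... | 2 , _ , (step e (step e′ here) , _) = _ , e , e′
  ... | suc (suc (suc _)) , s≤s (s≤s ()) , _

  probe-split : ∀ {S : Fin n → Set} p →
                Branch p (λ v → S v × Adj v p) → Branch p (λ v → S v × Far p v) → Locating G S
  probe-split {S} p near far = probe p answer
    where
    answer : ∀ d → Branch p (Answer G S p d)
    answer 0 = inj₁ (p , λ _ (_ , (w , _)) → walk-0 w)
    answer 1 = branch-mono (λ (Sv , (w , _)) → Sv , walk-1 w) near
    answer 2 = branch-mono (λ (Sv , dist) → Sv , dist-2 dist) far
    answer (suc (suc (suc k))) = inj₁ (p , λ _ (_ , dist) → ⊥-elim (dist-≥3 dist))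

  locate-single : ∀ {S : Fin n → Set} q → (∀ {v} → S v → v ≡ q) → Locating G S
  locate-single q single = probe-split q (inj₁ (q , λ _ (Sv , _) → single Sv))
                                         (inj₁ (q , λ _ (Sv , _) → single Sv))

  chord : ¬ Copy c5-edges → ∀ {a b c d} → Adj a b → Adj b c → Adj c d →
          a ≢ c → a ≢ d → b ≢ d → ¬ Adj a d → Adj a c ⊎ Adj b d
  chord noC5 {a} {b} {c} {d} ab bc cd a≢c a≢d b≢d ¬ad
    with common-neighbour a≢d ¬ad
  ... | e , ae , ed with e ≟ b | e ≟ c
  ... | yes refl | _ = inj₂ ed
  ... | no _ | yes refl = inj₁ ae
  ... | no e≢b | no e≢c =
    ⊥-elim (no-C5 noC5 ab bc cd (adj-sym ed) (adj-sym ae) a≢c a≢d b≢d (≢-sym e≢b) (≢-sym e≢c))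

-- Case 1: a universal vertex c

module UniversalVertex {n : ℕ} (G : SimpleGraph n) (diam : HasDiameter G 2)
  (noC5 : ¬ Graph.Copy G c5-edges) (noK4 : ¬ Graph.Copy G k4-edges)
  (noK2⊕E3 : ¬ Graph.Copy G k2⊕e3-edges)
  (c : Fin n) (universal : ∀ {v} → v ≢ c → Graph.Adj G c v) where
  open Graph G
  open Game G
  open Diameter2 G diam

  -- G − c has no triangle (with c it would be a K₄) ...
  no-triangle : ∀ {x y z} → x ≢ c → y ≢ c → z ≢ c → Adj x y → Adj y z → Adj x z → ⊥
  no-triangle x≢c y≢c z≢c xy yz xz =
    no-K4 noK4 (universal x≢c) (universal y≢c) (universal z≢c) xy xz yz

  -- ... and no path on four vertices (with c it would close a C₅)
  no-path4 : ∀ {a b d e} → a ≢ c → b ≢ c → d ≢ c → e ≢ c →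
             Adj a b → Adj b d → Adj d e → a ≢ d → a ≢ e → b ≢ e → ⊥
  no-path4 a≢c b≢c d≢c e≢c ab bd de a≢d a≢e b≢e =
    no-C5 noC5 ab bd de (adj-sym (universal e≢c)) (universal a≢c) a≢d a≢e b≢e b≢c d≢c

  -- m is the centre of a star component of G − c
  Star : Fin n → Set
  Star m = ∀ {y z} → Adj m y → y ≢ c → Adj y z → z ≢ c → z ≡ m

  middle-is-centre : ∀ {x y z} → x ≢ c → y ≢ c → z ≢ c →
                     Adj x y → Adj y z → z ≢ x → Star y
  middle-is-centre {x} {y} {z} x≢c y≢c z≢c xy yz z≢x {w} {v} yw w≢c wv v≢c with v ≟ y
  ... | yes v≡y = v≡y
  ... | no v≢y with w ≟ x
  ...   | yes refl with v ≟ z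
  ...     | yes refl = ⊥-elim (no-triangle x≢c y≢c z≢c xy yz wv)
  ...     | no v≢z = ⊥-elim (no-path4 v≢c x≢c y≢c z≢c (adj-sym wv) xy yz v≢y v≢z (≢-sym z≢x))
  middle-is-centre {x} {y} {z} x≢c y≢c z≢c xy yz z≢x {w} {v} yw w≢c wv v≢c
      | no v≢y | no w≢x with v ≟ x
  ...     | yes refl = ⊥-elim (no-triangle x≢c y≢c w≢c xy yw (adj-sym wv))
  ...     | no v≢x =
    ⊥-elim (no-path4 v≢c w≢c y≢c x≢c (adj-sym wv) (adj-sym yw) (adj-sym xy) v≢y v≢x w≢x)

  -- unions of components of G − c: the robber can leave them only to c
  record Closed (R : Fin n → Set) : Set where
    field
      avoids-c : ∀ {v} → R v → v ≢ c
      closed   : ∀ {v w} → R v → Adj v w → w ≢ c → R w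
  open Closed

  centre : ∀ {R} → Closed R → ∀ {x} → R x → ∃[ m ] (R m × Star m × (m ≡ x ⊎ Adj m x))
  centre cl {x} Rx with any? (λ y → any? λ z →
    adj? x y ×-dec ¬? (y ≟ c) ×-dec adj? y z ×-dec ¬? (z ≟ c) ×-dec ¬? (z ≟ x))
  ... | yes (y , z , xy , y≢c , yz , z≢c , z≢x) =
    y , closed cl Rx xy y≢c , middle-is-centre (avoids-c cl Rx) y≢c z≢c xy yz z≢x ,
    inj₂ (adj-sym xy)
  ... | no none = x , Rx , x-is-centre , inj₁ refl
    where
    x-is-centre : Star x
    x-is-centre {y} {z} xy y≢c yz z≢c with z ≟ x
    ... | yes z≡x = z≡x
    ... | no z≢x = ⊥-elim (none (y , z , xy , y≢c , yz , z≢c , z≢x))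

  Remove : (Fin n → Set) → Fin n → Fin n → Set
  Remove R m v = R v × v ≢ m × ¬ Adj m v

  removed : ∀ {R m x} → m ≡ x ⊎ Adj m x → ¬ Remove R m x
  removed (inj₁ refl) (_ , m≢m , _) = m≢m refl
  removed (inj₂ mx) (_ , _ , ¬mx) = ¬mx mx

  remove? : ∀ {R} → Decidable R → ∀ m → Decidable (Remove R m)
  remove? R? m v = R? v ×-dec ¬? (v ≟ m) ×-dec ¬? (adj? m v)

  remove-closed : ∀ {R m} → Closed R → Star m → Closed (Remove R m)
  remove-closed cl star .avoids-c (Rv , _) = avoids-c cl Rv
  remove-closed cl star .closed (Rv , v≢m , ¬mv) vw w≢c =
    closed cl Rv vw w≢c , (λ { refl → ¬mv (adj-sym vw) }) ,
    (λ mw → v≢m (star mw w≢c (adj-sym vw) (avoids-c cl Rv)))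

  move-avoiding-c : ∀ {R} → Closed R → Move G c R ⊆ R
  move-avoiding-c cl (v , Rv , inj₁ refl) = Rv
  move-avoiding-c cl (v , Rv , inj₂ (vw , w≢c)) = closed cl Rv vw w≢c

  move-closed : ∀ {R p} → Closed R → Move G p R ⊆ (λ w → R w ⊎ w ≡ c)
  move-closed cl (v , Rv , inj₁ refl) = inj₁ Rv
  move-closed cl {w} (v , Rv , inj₂ (vw , _)) with w ≟ c
  ... | yes w≡c = inj₂ w≡c
  ... | no w≢c = inj₁ (closed cl Rv vw w≢c)

  -- probing c first: c itself is at distance 0, everything else at distance 1
  add-c : ∀ {R} → Closed R → Locating G R → Locating G (λ v → R v ⊎ v ≡ c)
  add-c {R} cl locate-R =
    probe-split c
      (inj₂ (locating-mono (λ moved → move-avoiding-c cl (move-mono c near-in-R moved)) locate-R))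
      (inj₁ (c , λ _ (_ , v≢c , ¬vc) → ⊥-elim (¬vc (adj-sym (universal v≢c)))))
    where
    near-in-R : ∀ {v} → (R v ⊎ v ≡ c) × Adj v c → R v
    near-in-R (inj₁ Rv , _) = Rv
    near-in-R (inj₂ refl , cc) = ⊥-elim (adj⇒≢ cc refl)

  locate-leaf-pair : ∀ {m a d} → m ≢ c → a ≢ c → d ≢ c → Adj a m → Adj d m → d ≢ a →
                     Locating G (λ w → w ≡ a ⊎ w ≡ d ⊎ w ≡ c)
  locate-leaf-pair {m} {a} {d} m≢c a≢c d≢c am dm d≢a =
    probe-split a (inj₁ (c , near)) (inj₁ (d , far))
    where
    near : ∀ w → (w ≡ a ⊎ w ≡ d ⊎ w ≡ c) × Adj w a → w ≡ c
    near w (inj₁ refl , aa) = ⊥-elim (adj⇒≢ aa refl)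
    near w (inj₂ (inj₁ refl) , da) = ⊥-elim (no-triangle m≢c d≢c a≢c (adj-sym dm) da (adj-sym am))
    near w (inj₂ (inj₂ w≡c) , _) = w≡c
    far : ∀ w → (w ≡ a ⊎ w ≡ d ⊎ w ≡ c) × Far a w → w ≡ d
    far w (inj₁ refl , a≢a , _) = ⊥-elim (a≢a refl)
    far w (inj₂ (inj₁ w≡d) , _) = w≡d
    far w (inj₂ (inj₂ refl) , _ , ¬ca) = ⊥-elim (¬ca (universal a≢c))

  -- a star centre has at most two leaves (a third gives K₂ ⊕ E₃ with c), and
  -- a robber on a leaf can only move to c
  locate-leaves : ∀ {m} → m ≢ c → Star m → Branch m (λ v → v ≢ c × Adj v m)
  locate-leaves {m} m≢c star with any? (λ a → ¬? (a ≟ c) ×-dec adj? a m)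
  ... | no none = inj₁ (m , λ v leaf → ⊥-elim (none (v , leaf)))
  ... | yes (a , a≢c , am) with any? (λ d → ¬? (d ≟ c) ×-dec adj? d m ×-dec ¬? (d ≟ a))
  ...   | no none = inj₁ (a , only-a)
    where
    only-a : ∀ v → v ≢ c × Adj v m → v ≡ a
    only-a v (v≢c , vm) with v ≟ a
    ... | yes v≡a = v≡a
    ... | no v≢a = ⊥-elim (none (v , v≢c , vm , v≢a))
  ...   | yes (d , d≢c , dm , d≢a) =
    inj₂ (locating-mono trapped (locate-leaf-pair m≢c a≢c d≢c am dm d≢a))
    where
    a-or-d : ∀ {v} → v ≢ c → Adj v m → v ≡ a ⊎ v ≡ d ⊎ v ≡ c
    a-or-d {v} v≢c vm with v ≟ a | v ≟ d
    ... | yes v≡a | _ = inj₁ v≡a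
    ... | no _ | yes v≡d = inj₂ (inj₁ v≡d)
    ... | no v≢a | no v≢d = ⊥-elim (no-K2⊕E3 noK2⊕E3 (adj-sym (universal m≢c))
            (adj-sym am) (adj-sym dm) (adj-sym vm) (universal a≢c) (universal d≢c) (universal v≢c)
            (≢-sym d≢a) (≢-sym v≢a) (≢-sym v≢d))
    trapped : Move G m (λ v → v ≢ c × Adj v m) ⊆ (λ w → w ≡ a ⊎ w ≡ d ⊎ w ≡ c)
    trapped (v , (v≢c , vm) , inj₁ refl) = a-or-d v≢c vm
    trapped {w} (v , (v≢c , vm) , inj₂ (vw , w≢m)) with w ≟ c
    ... | yes w≡c = inj₂ (inj₂ w≡c)
    ... | no w≢c = ⊥-elim (w≢m (star (adj-sym vm) v≢c vw w≢c))

  locate-closed : ∀ (xs : List (Fin n)) {R} → Decidable R → Closed R →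
                  (∀ {v} → R v → v ∈ xs) → Locating G R
  locate-closed [] R? cl listed = locate-single c λ Rv → ⊥-elim (∉[] (listed Rv))
  locate-closed (x ∷ xs) {R} R? cl listed with R? x
  ... | no ¬Rx = locate-closed xs R? cl λ Rv → ∈-tail (λ { refl → ¬Rx Rv }) (listed Rv)
  ... | yes Rx with centre cl Rx
  ...   | m , Rm , star , m-near-x =
    probe-split m
      (branch-mono (λ (Rv , vm) → avoids-c cl Rv , vm) (locate-leaves (avoids-c cl Rm) star))
      (inj₂ (locating-mono escaped
        (add-c rest-closed (locate-closed xs (remove? R? m) rest-closed listed′))))
    where
    rest-closed : Closed (Remove R m)
    rest-closed = remove-closed cl star
    far-is-removed : ∀ {v} → R v × Far m v → Remove R m v
    far-is-removed (Rv , v≢m , ¬vm) = Rv , v≢m , λ mv → ¬vm (adj-sym mv)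
    escaped : Move G m (λ v → R v × Far m v) ⊆ (λ w → Remove R m w ⊎ w ≡ c)
    escaped moved = move-closed rest-closed (move-mono m far-is-removed moved)
    listed′ : ∀ {v} → Remove R m v → v ∈ xs
    listed′ rest =
      ∈-tail (λ v≡x → removed {R} m-near-x (subst (Remove R m) v≡x rest)) (listed (proj₁ rest))

  locatable : Locatable G
  locatable = locating-mono c-or-not
    (add-c off-c (locate-closed (allFin n) (λ v → ¬? (v ≟ c)) off-c (λ _ → ∈-allFin _)))
    where
    off-c : Closed (_≢ c)
    off-c .avoids-c v≢c = v≢c
    off-c .closed _ _ w≢c = w≢c
    c-or-not : ∀ {v} → ⊤ → v ≢ c ⊎ v ≡ c
    c-or-not {v} _ with v ≟ c
    ... | yes v≡c = inj₂ v≡c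
    ... | no v≢c = inj₁ v≢c

-- Case 2: no universal vertex; G is complete bipartite with one side {a, b}

module NoUniversalVertex {n : ℕ} (G : SimpleGraph n) (diam : HasDiameter G 2)
  (noC5 : ¬ Graph.Copy G c5-edges) (noK4 : ¬ Graph.Copy G k4-edges)
  (noK33 : ¬ Graph.Copy G k33-edges)
  (non-neighbour : ∀ v → ∃[ w ] (w ≢ v × ¬ Graph.Adj G w v)) where
  open Graph G
  open Diameter2 G diam

  -- a common neighbour of a corner x of a triangle xyz and a non-neighbour w
  -- of x lies on the triangle (otherwise a C₅ or, via chords, a K₄ appears)
  through-triangle : ∀ {x y z w p} → Adj x y → Adj y z → Adj x z →
                     w ≢ x → ¬ Adj w x → Adj w p → Adj p x → p ≡ y ⊎ p ≡ z
  through-triangle {x} {y} {z} {w} {p} xy yz xz w≢x ¬wx wp px with p ≟ y | p ≟ z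
  ... | yes p≡y | _ = inj₁ p≡y
  ... | no _ | yes p≡z = inj₂ p≡z
  ... | no p≢y | no p≢z with adj? w y | adj? w z
  ...   | yes wy | _ =
    ⊥-elim (no-C5 noC5 wy yz (adj-sym xz) (adj-sym px) (adj-sym wp)
                          w≢z w≢x (adj⇒≢ (adj-sym xy)) (≢-sym p≢y) (≢-sym p≢z))
    where
    w≢z : w ≢ z
    w≢z refl = ¬wx (adj-sym xz)
  ...   | no _ | yes wz =
    ⊥-elim (no-C5 noC5 wz (adj-sym yz) (adj-sym xy) (adj-sym px) (adj-sym wp)
                          w≢y w≢x (adj⇒≢ (adj-sym xz)) (≢-sym p≢z) (≢-sym p≢y))
    where
    w≢y : w ≢ y
    w≢y refl = ¬wx (adj-sym xy)
  ...   | no ¬wy | no ¬wz =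
    ⊥-elim (no-K4 noK4 px (corner y xy ¬wy p≢y) (corner z xz ¬wz p≢z) xy xz yz)
    where
    -- the path w − p − x − t has the chord pt
    corner : ∀ t → Adj x t → ¬ Adj w t → p ≢ t → Adj p t
    corner t xt ¬wt p≢t with chord noC5 wp px xt w≢x (λ { refl → ¬wx (adj-sym xt) }) p≢t ¬wt
    ... | inj₁ wx = ⊥-elim (¬wx wx)
    ... | inj₂ pt = pt

  spread : ∀ {x y z w u s} → Adj x y → Adj y z → Adj x z → w ≢ x → ¬ Adj w x →
           Adj u x → u ≢ y → u ≢ z → Adj w s → Adj s x → Adj u s
  spread {x} {y} {z} {w} {u} {s} xy yz xz w≢x ¬wx ux u≢y u≢z ws sx
    with chord noC5 ux (adj-sym sx) (adj-sym ws) u≢s (λ { refl → ¬wx ux }) (≢-sym w≢x) ¬uw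
    where
    u≢s : u ≢ s
    u≢s refl with through-triangle xy yz xz w≢x ¬wx ws sx
    ... | inj₁ u≡y = u≢y u≡y
    ... | inj₂ u≡z = u≢z u≡z
    ¬uw : ¬ Adj u w
    ¬uw uw with through-triangle xy yz xz w≢x ¬wx (adj-sym uw) ux
    ... | inj₁ u≡y = u≢y u≡y
    ... | inj₂ u≡z = u≢z u≡z
  ... | inj₁ us = us
  ... | inj₂ xw = ⊥-elim (¬wx (adj-sym xw))

  -- No triangle xyz has a vertex w₁ adjacent to y but not to x: spreading
  -- along a non-neighbour w₂ of y and then a non-neighbour w₃ of z forces w₁
  -- or w₂ onto the triangle vertex it avoids.
  lopsided-triangle : ∀ {x y z w₁} → Adj x y → Adj y z → Adj x z →
                      w₁ ≢ x → ¬ Adj w₁ x → Adj w₁ y → ⊥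
  lopsided-triangle {x} {y} {z} {w₁} xy yz xz w₁≢x ¬w₁x w₁y with non-neighbour y
  ... | w₂ , w₂≢y , ¬w₂y with common-neighbour w₂≢y ¬w₂y
  ...   | q , w₂q , qy
    with through-triangle (adj-sym xy) xz yz w₂≢y ¬w₂y w₂q qy
       | spread (adj-sym xy) xz yz w₂≢y ¬w₂y w₁y w₁≢x (λ { refl → ¬w₁x (adj-sym xz) }) w₂q qy
  ...   | inj₁ refl | w₁x = ¬w₁x w₁x
  ...   | inj₂ refl | w₁z with non-neighbour z
  ...     | w₃ , w₃≢z , ¬w₃z with common-neighbour w₃≢z ¬w₃z
  ...       | s , w₃s , sz
    with through-triangle (adj-sym xz) xy (adj-sym yz) w₃≢z ¬w₃z w₃s sz
       | spread (adj-sym xz) xy (adj-sym yz) w₃≢z ¬w₃z w₁z w₁≢x (adj⇒≢ w₁y) w₃s sz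
       | spread (adj-sym xz) xy (adj-sym yz) w₃≢z ¬w₃z w₂q (λ { refl → ¬w₂y xy }) w₂≢y w₃s sz
  ...       | inj₁ refl | w₁x | _ = ¬w₁x w₁x
  ...       | inj₂ refl | _ | w₂y = ¬w₂y w₂y

  -- G is triangle-free: a non-neighbour of x meets the triangle xyz at y or z
  triangle-free : ∀ {x y z} → Adj x y → Adj y z → Adj x z → ⊥
  triangle-free {x} {y} {z} xy yz xz with non-neighbour x
  ... | w₁ , w₁≢x , ¬w₁x with common-neighbour w₁≢x ¬w₁x
  ...   | p , w₁p , px with through-triangle xy yz xz w₁≢x ¬w₁x w₁p px
  ...     | inj₁ refl = lopsided-triangle xy yz xz w₁≢x ¬w₁x w₁p
  ...     | inj₂ refl = lopsided-triangle xz (adj-sym yz) xy w₁≢x ¬w₁x w₁p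

  cover : ∀ {x y} → Adj x y → ∀ v → Adj x v ⊎ Adj y v
  cover {x} {y} xy v with v ≟ x | v ≟ y
  ... | yes refl | _ = inj₂ (adj-sym xy)
  ... | no _ | yes refl = inj₁ xy
  ... | no v≢x | no v≢y with adj? x v | adj? y v
  ...   | yes xv | _ = inj₁ xv
  ...   | no _ | yes yv = inj₂ yv
  ...   | no ¬xv | no ¬yv with common-neighbour v≢x (λ vx → ¬xv (adj-sym vx))
  ...     | q , vq , qx
    with chord noC5 vq qx xy v≢x v≢y (λ { refl → ¬yv (adj-sym vq) }) (λ vy → ¬yv (adj-sym vy))
  ...     | inj₁ vx = ⊥-elim (¬xv (adj-sym vx))
  ...     | inj₂ qy = ⊥-elim (triangle-free qx xy qy)

  across : ∀ {x y w} → Adj x y → ¬ Adj w x → Adj y w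
  across {w = w} xy ¬wx with cover xy w
  ... | inj₁ xw = ⊥-elim (¬wx (adj-sym xw))
  ... | inj₂ yw = yw

  complete : ∀ {x y u w} → Adj x y → Adj y u → Adj x w → Adj u w
  complete {x} {y} {u} {w} xy yu xw with u ≟ x | w ≟ y
  ... | yes refl | _ = xw
  ... | no _ | yes refl = adj-sym yu
  ... | no u≢x | no w≢y with adj? u w
  ...   | yes uw = uw
  ...   | no ¬uw with chord noC5 (adj-sym yu) (adj-sym xy) xw u≢x
                        (λ { refl → triangle-free xy yu xw }) (≢-sym w≢y) ¬uw
  ...     | inj₁ ux = ⊥-elim (triangle-free xy yu (adj-sym ux))
  ...     | inj₂ yw = ⊥-elim (triangle-free xy yw xw)

  hubs-from-edge : ∀ {x y w} → Adj x y → ¬ Adj w x →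
                   (∀ {t} → Adj y t → t ≢ x → t ≢ w → ⊥) → Hubs x w
  hubs-from-edge {x} {y} {w} xy ¬wx only-x-w = record
    { apart    = λ xw → ¬wx (adj-sym xw)
    ; joined   = λ v≢x v≢w → adj-sym (to-x v≢x v≢w) ,
                             adj-sym (complete xy (across xy ¬wx) (to-x v≢x v≢w))
    ; confined = confined
    }
    where
    to-x : ∀ {v} → v ≢ x → v ≢ w → Adj x v
    to-x {v} v≢x v≢w with cover xy v
    ... | inj₁ xv = xv
    ... | inj₂ yv = ⊥-elim (only-x-w yv v≢x v≢w)
    confined : ∀ {v u} → v ≢ x → v ≢ w → Adj v u → u ≡ x ⊎ u ≡ w
    confined {v} {u} v≢x v≢w vu with cover xy u
    ... | inj₁ xu = ⊥-elim (triangle-free (to-x v≢x v≢w) vu xu)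
    ... | inj₂ yu with u ≟ x | u ≟ w
    ...   | yes u≡x | _ = inj₁ u≡x
    ...   | no _ | yes u≡w = inj₂ u≡w
    ...   | no u≢x | no u≢w = ⊥-elim (only-x-w yu u≢x u≢w)

  -- around an edge xy: either end has only two "far-side" neighbours, or the
  -- two sides contain a K₃,₃
  hubs-around : ∀ {x y} → Adj x y → ∃[ a ] ∃[ b ] Hubs a b
  hubs-around {x} {y} xy with non-neighbour x | non-neighbour y
  ... | w , w≢x , ¬wx | w′ , w′≢y , ¬w′y
    with any? (λ t → adj? y t ×-dec ¬? (t ≟ x) ×-dec ¬? (t ≟ w))
  ... | no none = x , w , hubs-from-edge xy ¬wx λ yt t≢x t≢w → none (_ , yt , t≢x , t≢w)
  ... | yes (t , yt , t≢x , t≢w)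
    with any? (λ t′ → adj? x t′ ×-dec ¬? (t′ ≟ y) ×-dec ¬? (t′ ≟ w′))
  ...   | no none =
    y , w′ , hubs-from-edge (adj-sym xy) ¬w′y λ xt t≢y t≢w′ → none (_ , xt , t≢y , t≢w′)
  ...   | yes (t′ , xt′ , t′≢y , t′≢w′) = ⊥-elim (no-K33 noK33
      (join yx xy) (join yx xw′) (join yx xt′) (join yw xy) (join yw xw′) (join yw xt′)
      (join yt xy) (join yt xw′) (join yt xt′)
      (≢-sym w≢x) (≢-sym t≢x) (≢-sym t≢w) (≢-sym w′≢y) (≢-sym t′≢y) (≢-sym t′≢w′))
    where
    join : ∀ {u v} → Adj y u → Adj x v → Adj u v
    join = complete xy
    yx : Adj y x
    yx = adj-sym xy
    yw : Adj y w
    yw = across xy ¬wx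
    xw′ : Adj x w′
    xw′ = across (adj-sym xy) ¬w′y

  find-hubs : ∃[ a ] ∃[ b ] Hubs a b
  find-hubs with proj₂ diam
  ... | _ , _ , (step xy _ , _) = hubs-around xy

-- Locating the robber when G has hubs a, b

module LocateHubs {n : ℕ} (G : SimpleGraph n) (diam : HasDiameter G 2)
  {a b : Fin n} (hubs : Graph.Hubs G a b) where
  open Graph G
  open Game G
  open Diameter2 G diam
  open Hubs hubs

  Other : Fin n → Set
  Other v = v ≢ a × v ≢ b

  -- probing a: the other vertices are its neighbours and can then only
  -- stay or step to b, while b alone is at distance 2
  probe-hub : ∀ {Y} → Y ⊆ Other → Locating G (λ v → Y v ⊎ v ≡ b) →
              Locating G (λ v → Y v ⊎ v ≡ a ⊎ v ≡ b)
  probe-hub {Y} Y⊆Other locate =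
    probe-split a (inj₂ (locating-mono moved locate)) (inj₁ (b , far))
    where
    near-in-Y : ∀ {v} → (Y v ⊎ v ≡ a ⊎ v ≡ b) × Adj v a → Y v
    near-in-Y (inj₁ Yv , _) = Yv
    near-in-Y (inj₂ (inj₁ refl) , aa) = ⊥-elim (adj⇒≢ aa refl)
    near-in-Y (inj₂ (inj₂ refl) , ba) = ⊥-elim (apart (adj-sym ba))
    moved : Move G a (λ v → (Y v ⊎ v ≡ a ⊎ v ≡ b) × Adj v a) ⊆ (λ w → Y w ⊎ w ≡ b)
    moved (v , candidate , inj₁ refl) = inj₁ (near-in-Y candidate)
    moved (v , candidate , inj₂ (vw , w≢a)) with Y⊆Other (near-in-Y candidate)
    ... | v≢a , v≢b with confined v≢a v≢b vw
    ...   | inj₁ w≡a = ⊥-elim (w≢a w≡a)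
    ...   | inj₂ w≡b = inj₂ w≡b
    far : ∀ v → (Y v ⊎ v ≡ a ⊎ v ≡ b) × Far a v → v ≡ b
    far v (inj₁ Yv , _ , ¬va) with Y⊆Other Yv
    ... | v≢a , v≢b = ⊥-elim (¬va (proj₁ (joined v≢a v≢b)))
    far v (inj₂ (inj₁ v≡a) , v≢a , _) = ⊥-elim (v≢a v≡a)
    far v (inj₂ (inj₂ v≡b) , _) = v≡b

  locate-others : ∀ (xs : List (Fin n)) → Locating G (λ v → (Other v × v ∈ xs) ⊎ v ≡ b)
  locate-others [] = locate-single b λ { (inj₁ (_ , ())) ; (inj₂ v≡b) → v≡b }
  locate-others (x ∷ xs) with ¬? (x ≟ a) ×-dec ¬? (x ≟ b)
  ... | no ¬other = locating-mono skip (locate-others xs)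
    where
    skip : ∀ {v} → (Other v × v ∈ x ∷ xs) ⊎ v ≡ b → (Other v × v ∈ xs) ⊎ v ≡ b
    skip (inj₁ (other , v∈)) = inj₁ (other , ∈-tail (λ v≡x → ¬other (subst Other v≡x other)) v∈)
    skip (inj₂ v≡b) = inj₂ v≡b
  ... | yes (x≢a , x≢b) =
    probe-split x (inj₁ (b , near)) (inj₂ (locating-mono moved (probe-hub proj₁ (locate-others xs))))
    where
    near : ∀ v → ((Other v × v ∈ x ∷ xs) ⊎ v ≡ b) × Adj v x → v ≡ b
    near v (inj₁ ((v≢a , v≢b) , _) , vx) with confined v≢a v≢b vx
    ... | inj₁ x≡a = ⊥-elim (x≢a x≡a)
    ... | inj₂ x≡b = ⊥-elim (x≢b x≡b)
    near v (inj₂ v≡b , _) = v≡b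
    rest : ∀ {v} → ((Other v × v ∈ x ∷ xs) ⊎ v ≡ b) × Far x v → Other v × v ∈ xs
    rest (inj₁ (other , v∈) , v≢x , _) = other , ∈-tail v≢x v∈
    rest (inj₂ refl , _ , ¬bx) = ⊥-elim (¬bx (adj-sym (proj₂ (joined x≢a x≢b))))
    moved : Move G x (λ v → ((Other v × v ∈ x ∷ xs) ⊎ v ≡ b) × Far x v) ⊆
            (λ w → (Other w × w ∈ xs) ⊎ w ≡ a ⊎ w ≡ b)
    moved (v , candidate , inj₁ refl) = inj₁ (rest candidate)
    moved (v , candidate , inj₂ (vw , _)) with rest candidate
    ... | (v≢a , v≢b) , _ = inj₂ (confined v≢a v≢b vw)

  locatable : Locatable G
  locatable = locating-mono classify (probe-hub proj₁ (locate-others (allFin n)))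
    where
    classify : ∀ {v} → ⊤ → (Other v × v ∈ allFin n) ⊎ v ≡ a ⊎ v ≡ b
    classify {v} _ with v ≟ a | v ≟ b
    ... | yes v≡a | _ = inj₂ (inj₁ v≡a)
    ... | no _ | yes v≡b = inj₂ (inj₂ v≡b)
    ... | no v≢a | no v≢b = inj₁ ((v≢a , v≢b) , ∈-allFin v)

locatable : ∀ {n} (G : SimpleGraph n) → HasDiameter G 2 →
            ¬ Graph.Copy G c5-edges → ¬ Graph.Copy G k4-edges →
            ¬ Graph.Copy G k2⊕e3-edges → ¬ Graph.Copy G k33-edges → Locatable G
locatable G diam noC5 noK4 noK2⊕E3 noK33 with Graph.universal-or-not G
... | inj₁ (c , universal) = UniversalVertex.locatable G diam noC5 noK4 noK2⊕E3 c universal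
... | inj₂ non-neighbour with NoUniversalVertex.find-hubs G diam noC5 noK4 noK33 non-neighbour
...   | _ , _ , hubs = LocateHubs.locatable G diam hubs

lemma3p2 : ∀ {n : ℕ} (G : SimpleGraph n) → HasDiameter G 2 → ¬ Locatable G →
    ContainsSubgraph G C5 ⊎ ContainsSubgraph G K4 ⊎ ContainsSubgraph G K2⊕E3 ⊎ ContainsSubgraph G K33
lemma3p2 G diam not-locatable
  with search c5-described | search k4-described | search k2⊕e3-described | search k33-described
  where open Graph G using (search)
... | inj₁ c5 | _ | _ | _ = inj₁ c5
... | inj₂ _ | inj₁ k4 | _ | _ = inj₂ (inj₁ k4)
... | inj₂ _ | inj₂ _ | inj₁ k2⊕e3 | _ = inj₂ (inj₂ (inj₁ k2⊕e3))
... | inj₂ _ | inj₂ _ | inj₂ _ | inj₁ k33 = inj₂ (inj₂ (inj₂ k33))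
... | inj₂ noC5 | inj₂ noK4 | inj₂ noK2⊕E3 | inj₂ noK33 =
  ⊥-elim (not-locatable (locatable G diam noC5 noK4 noK2⊕E3 noK33))
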